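{- For $n\ge 2$, $\mathrm{thin}_{cmp,prec}(CR_n)=2n-2$, and $\mathrm{thin}_{cmp,prec}(CR_1)=2$. The same values hold for the precedence complete proper thinness $\mathrm{pthin}_{cmp,prec}(CR_n)$.
   Context: The crown graph $CR_n$ is obtained from $K_{n,n}$ by removing a perfect matching. An ordering $<$ of $V(G)$ is consistent with a partition $\mathcal{V}$ if for every $p<q<r$ with $p,q$ in the same class and $pr\in E(G)$, also $qr\in E(G)$; strongly consistent if both $<$ and its reversal are consistent. $\mathrm{thin}_{cmp,prec}(G)$ (resp. $\mathrm{pthin}_{cmp,prec}(G)$) is the minimum $k$ such that $V(G)$ has a partition into $k$ cliques and an ordering consistent (resp. strongly consistent) with it in which each class is consecutive. -}

module Defs where

open import Data.Nat using (ℕ; _<_; _≤_)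
open import Data.Fin using (Fin)
open import Data.Sum using (_⊎_; inj₁; inj₂)
open import Data.Product using (_×_; Σ; ∃)
open import Data.Empty using (⊥)
open import Data.Unit using (⊤)
open import Relation.Nullary using (¬_)
open import Relation.Binary.PropositionalEquality using (_≡_; _≢_)
open import Function.Definitions using (Injective; Surjective)

record Graph : Set₁ where
  field
    V : Set
    E : V → V → Set
open Graph public

-- Crown graph CR_n: K_{n,n} (sides inj₁ / inj₂ of Fin n) minus the perfect
-- matching {inj₁ i , inj₂ i}.
CrownE : (n : ℕ) → Fin n ⊎ Fin n → Fin n ⊎ Fin n → Set
CrownE n (inj₁ i) (inj₁ j) = ⊥
CrownE n (inj₁ i) (inj₂ j) = i ≢ j
CrownE n (inj₂ i) (inj₁ j) = i ≢ j
CrownE n (inj₂ i) (inj₂ j) = ⊥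

CR : ℕ → Graph
CR n = record { V = Fin n ⊎ Fin n ; E = CrownE n }

module _ (G : Graph) where
  -- A vertex ordering is given by an injective rank map σ : V → ℕ
  -- (p < q  iff  σ p < σ q); a partition into k classes by a surjective
  -- class map c : V → Fin k.

  CliqueClasses : ∀ {k} → (V G → Fin k) → Set
  CliqueClasses c = ∀ u v → c u ≡ c v → u ≢ v → E G u v

  Consecutive : ∀ {k} → (V G → ℕ) → (V G → Fin k) → Set
  Consecutive σ c = ∀ p q r → σ p < σ q → σ q < σ r → c p ≡ c r → c q ≡ c p

  Consistent : ∀ {k} → (V G → ℕ) → (V G → Fin k) → Set
  Consistent σ c = ∀ p q r → σ p < σ q → σ q < σ r →
                   c p ≡ c q → E G p r → E G q r

  ReverseConsistent : ∀ {k} → (V G → ℕ) → (V G → Fin k) → Set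
  ReverseConsistent σ c = ∀ p q r → σ r < σ q → σ q < σ p →
                          c p ≡ c q → E G p r → E G q r

  StronglyConsistent : ∀ {k} → (V G → ℕ) → (V G → Fin k) → Set
  StronglyConsistent σ c = Consistent σ c × ReverseConsistent σ c

  HasCmpPrecPartition : ℕ → Set
  HasCmpPrecPartition k =
    Σ (V G → Fin k) λ c → Σ (V G → ℕ) λ σ →
      Surjective _≡_ _≡_ c × Injective _≡_ _≡_ σ ×
      CliqueClasses c × Consecutive σ c × Consistent σ c

  HasCmpPrecProperPartition : ℕ → Set
  HasCmpPrecProperPartition k =
    Σ (V G → Fin k) λ c → Σ (V G → ℕ) λ σ →
      Surjective _≡_ _≡_ c × Injective _≡_ _≡_ σ ×
      CliqueClasses c × Consecutive σ c × StronglyConsistent σ c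

IsMinimum : (ℕ → Set) → ℕ → Set
IsMinimum P k = P k × (∀ j → P j → k ≤ j)

ThinCmpPrec≡ : Graph → ℕ → Set
ThinCmpPrec≡ G = IsMinimum (HasCmpPrecPartition G)

PThinCmpPrec≡ : Graph → ℕ → Set
PThinCmpPrec≡ G = IsMinimum (HasCmpPrecProperPartition G)

{-# OPTIONS --safe #-}
-- Cliques of the triangle-free crown graph have at most two vertices.  In a
-- consecutive consistent ordering, every neighbour of the first vertex u of a
-- two-vertex class {u, v}, except v, precedes u.  Comparing two such classes
-- through the twins (the removed matching partners) of their first vertices
-- shows that the later vertex of the earlier class precedes its twin while the
-- later vertex of the later class follows its twin.  So the second vertices of
-- the classes are told apart by one bit, which leaves room for at most two
-- two-vertex classes: 2n ≤ k + 2.  Conversely, the two classes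
-- {inj₁ 0, inj₂ 1} and {inj₁ 1, inj₂ 0} plus singletons can be ordered so that
-- consistency holds in both directions vacuously.
module Submission where

open import Defs
open import Data.Bool using (Bool; true; false; T)
open import Data.Nat using (ℕ; zero; suc; _+_; _*_; _∸_; _≤_; _<_; z≤n; s≤s; _<?_)
open import Data.Nat.Properties
open import Data.Fin using (Fin; zero; suc; toℕ; cast; splitAt; join; _↑ʳ_)
  renaming (_≟_ to _≟ᶠ_)
open import Data.Fin.Properties
  using (¬Fin0; any?; injective⇒≤; toℕ-injective; toℕ-↑ˡ; toℕ-↑ʳ; toℕ<n; cast-involutive;
         splitAt-join; join-splitAt; +↔⊎; 2↔Bool)
open import Data.Sum using (_⊎_; inj₁; inj₂; map; [_,_]′)
open import Data.Sum.Properties using (inj₁-injective; inj₂-injective)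
open import Data.Sum.Function.Propositional using (_⊎-↔_)
open import Data.Product using (_×_; ∃; _,_)
open import Data.Empty using (⊥; ⊥-elim)
open import Data.Unit using (tt)
open import Function using (_∘_; id; _↔_; module Injection)
open import Function.Definitions using (Injective; Surjective)
open import Function.Properties.Inverse using (↔-refl; ↔-sym; ↔-trans; ↔⇒↣)
open import Relation.Nullary using (¬_; Dec; yes; no; does)
open import Relation.Nullary.Decidable using (map′; _⊎-dec_; _×-dec_; dec-true; dec-false)
open import Relation.Binary using (tri<; tri≈; tri>)
open import Relation.Binary.PropositionalEquality

injective⇒card≤ : ∀ {A B : Set} {a b} → A ↔ Fin a → B ↔ Fin b →
                  {f : A → B} → Injective _≡_ _≡_ f → a ≤ b
injective⇒card≤ A↔a B↔b f-injective =
  injective⇒≤ (Injection.injective (↔⇒↣ (↔-sym A↔a)) ∘ f-injective ∘ Injection.injective (↔⇒↣ B↔b))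

does-<?-≢ : ∀ {x y x′ y′} → x < y → y′ < x′ → does (x <? y) ≢ does (x′ <? y′)
does-<?-≢ {x} {y} {x′} {y′} x<y y′<x′ eq =
  subst T (trans (sym (dec-true (x <? y) x<y)) (trans eq (dec-false (x′ <? y′) (<-asym y′<x′)))) tt

proper⇒partition : ∀ G {k} → HasCmpPrecProperPartition G k → HasCmpPrecPartition G k
proper⇒partition G (c , σ , surj , inj , cliques , consec , consistent , _) =
  c , σ , surj , inj , cliques , consec , consistent

module _ (G : Graph) {k : ℕ} (c : V G → Fin k) (σ : V G → ℕ) where

  monotone⇒consecutive : (∀ {p q} → σ p < σ q → toℕ (c p) ≤ toℕ (c q)) → Consecutive G σ c
  monotone⇒consecutive mono p q r p<q q<r cp≡cr = toℕ-injective (≤-antisym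
    (subst (λ j → toℕ (c q) ≤ toℕ j) (sym cp≡cr) (mono q<r)) (mono p<q))

  neighbours-precede⇒consistent :
    (∀ p q r → σ p < σ q → c p ≡ c q → E G p r → σ r ≤ σ q) → Consistent G σ c
  neighbours-precede⇒consistent precede p q r p<q q<r cp≡cq pr =
    ⊥-elim (<⇒≱ q<r (precede p q r p<q cp≡cq pr))

  neighbours-follow⇒reverseConsistent :
    (∀ p q r → σ p < σ q → c p ≡ c q → E G q r → σ p ≤ σ r) → ReverseConsistent G σ c
  neighbours-follow⇒reverseConsistent follow p q r r<q q<p cp≡cq pr =
    ⊥-elim (<⇒≱ r<q (follow q p r q<p (sym cp≡cq) pr))

TriangleFree : Graph → Set
TriangleFree G = ∀ a b d → E G a b → E G b d → E G a d → ⊥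

module ConsistentCliquePartition
  (G : Graph) (irreflexive : ∀ v → ¬ E G v v) (triangle-free : TriangleFree G)
  {k : ℕ} (c : V G → Fin k) (σ : V G → ℕ) (σ-injective : Injective _≡_ _≡_ σ)
  (cliques : CliqueClasses G c) (consecutive : Consecutive G σ c)
  (consistent : Consistent G σ c)
  where

  σ<⇒≢ : ∀ {a b} → σ a < σ b → a ≢ b
  σ<⇒≢ a<b refl = <-irrefl refl a<b

  no-three-in-class : ∀ {a b d} → c a ≡ c b → c b ≡ c d → σ a < σ b → σ b < σ d → ⊥
  no-three-in-class {a} {b} {d} ca≡cb cb≡cd a<b b<d = triangle-free a b d
    (cliques a b ca≡cb (σ<⇒≢ a<b))
    (cliques b d cb≡cd (σ<⇒≢ b<d))
    (cliques a d (trans ca≡cb cb≡cd) (σ<⇒≢ (<-trans a<b b<d)))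

  neighbour-of-first-precedes : ∀ {u v r} → c u ≡ c v → σ u < σ v →
                                E G u r → r ≢ v → σ r < σ u
  neighbour-of-first-precedes {u} {v} {r} cu≡cv u<v ur r≢v with <-cmp (σ r) (σ u)
  ... | tri< r<u _ _ = r<u
  ... | tri≈ _ r≈u _ = ⊥-elim (irreflexive u (subst (E G u) (σ-injective r≈u) ur))
  ... | tri> _ _ u<r with <-cmp (σ r) (σ v)
  ...   | tri< r<v _ _ = let cr≡cu = consecutive u r v u<r r<v cu≡cv in
                         ⊥-elim (no-three-in-class (sym cr≡cu) (trans cr≡cu cu≡cv) u<r r<v)
  ...   | tri≈ _ r≈v _ = ⊥-elim (r≢v (σ-injective r≈v))
  ...   | tri> _ _ v<r = ⊥-elim (triangle-free u v r
                           (cliques u v cu≡cv (σ<⇒≢ u<v)) (consistent u v r u<v v<r cu≡cv ur) ur)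

  mate-precedes-other-class : ∀ {u v w} → c u ≡ c v → σ u < σ w → c v ≢ c w → σ v < σ w
  mate-precedes-other-class {u} {v} {w} cu≡cv u<w cv≢cw with <-cmp (σ v) (σ w)
  ... | tri< v<w _ _ = v<w
  ... | tri≈ _ v≈w _ = ⊥-elim (cv≢cw (cong c (σ-injective v≈w)))
  ... | tri> _ _ w<v = ⊥-elim (cv≢cw (trans (sym cu≡cv) (sym (consecutive u w v u<w w<v cu≡cv))))

  HasEarlierMate : V G → Set
  HasEarlierMate v = ∃ λ u → c u ≡ c v × σ u < σ v

  first-in-class-unique : ∀ {v w} → ¬ HasEarlierMate v → ¬ HasEarlierMate w →
                          c v ≡ c w → v ≡ w
  first-in-class-unique {v} {w} v-first w-first cv≡cw with <-cmp (σ v) (σ w)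
  ... | tri< v<w _ _ = ⊥-elim (w-first (v , cv≡cw , v<w))
  ... | tri≈ _ v≈w _ = σ-injective v≈w
  ... | tri> _ _ w<v = ⊥-elim (v-first (w , sym cv≡cw , w<v))

  second-in-class-unique : ∀ {v w} → HasEarlierMate v → HasEarlierMate w →
                           c v ≡ c w → v ≡ w
  second-in-class-unique {v} {w} (u , cu≡cv , u<v) (u′ , cu′≡cw , u′<w) cv≡cw
    with <-cmp (σ v) (σ w)
  ... | tri< v<w _ _ = ⊥-elim (no-three-in-class cu≡cv cv≡cw u<v v<w)
  ... | tri≈ _ v≈w _ = σ-injective v≈w
  ... | tri> _ _ w<v = ⊥-elim (no-three-in-class cu′≡cw (sym cv≡cw) u′<w w<v)

≢⊎≡ : ∀ {n} (i j : Fin n) → i ≢ j ⊎ j ≡ i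
≢⊎≡ i j with i ≟ᶠ j
... | yes i≡j = inj₂ (sym i≡j)
... | no i≢j = inj₁ i≢j

module _ {n : ℕ} where

  twin : Fin n ⊎ Fin n → Fin n ⊎ Fin n
  twin (inj₁ i) = inj₂ i
  twin (inj₂ i) = inj₁ i

  twin-involutive : ∀ u → twin (twin u) ≡ u
  twin-involutive (inj₁ i) = refl
  twin-involutive (inj₂ i) = refl

  CrownE-irrefl : ∀ v → ¬ CrownE n v v
  CrownE-irrefl (inj₁ i) ()
  CrownE-irrefl (inj₂ i) ()

  CrownE-sym : ∀ u v → CrownE n u v → CrownE n v u
  CrownE-sym (inj₁ i) (inj₂ j) i≢j = i≢j ∘ sym
  CrownE-sym (inj₂ i) (inj₁ j) i≢j = i≢j ∘ sym

  CrownE-triangle-free : TriangleFree (CR n)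
  CrownE-triangle-free (inj₁ _) (inj₂ _) (inj₁ _) _ _ ()
  CrownE-triangle-free (inj₂ _) (inj₁ _) (inj₂ _) _ _ ()

  edge-meets-neighbour-or-twin : ∀ u a b → CrownE n a b →
    (CrownE n u a ⊎ a ≡ twin u) ⊎ (CrownE n u b ⊎ b ≡ twin u)
  edge-meets-neighbour-or-twin (inj₁ i) (inj₁ _) (inj₂ j) _ = inj₂ (map id (cong inj₂) (≢⊎≡ i j))
  edge-meets-neighbour-or-twin (inj₁ i) (inj₂ j) (inj₁ _) _ = inj₁ (map id (cong inj₂) (≢⊎≡ i j))
  edge-meets-neighbour-or-twin (inj₂ i) (inj₁ j) (inj₂ _) _ = inj₁ (map id (cong inj₁) (≢⊎≡ i j))
  edge-meets-neighbour-or-twin (inj₂ i) (inj₂ _) (inj₁ j) _ = inj₂ (map id (cong inj₁) (≢⊎≡ i j))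
  edge-meets-neighbour-or-twin _ (inj₁ _) (inj₁ _) ()
  edge-meets-neighbour-or-twin _ (inj₂ _) (inj₂ _) ()

  twin-adjacent-swap : ∀ u u′ → u ≢ u′ → CrownE n u′ (twin u) → CrownE n u (twin u′)
  twin-adjacent-swap (inj₁ i) (inj₁ j) u≢u′ _ = u≢u′ ∘ cong inj₁
  twin-adjacent-swap (inj₂ i) (inj₂ j) u≢u′ _ = u≢u′ ∘ cong inj₂

  ∃-⊎? : {P : Fin n ⊎ Fin n → Set} → (∀ v → Dec (P v)) → Dec (∃ P)
  ∃-⊎? P? = map′
    (λ { (inj₁ (i , p)) → inj₁ i , p ; (inj₂ (i , p)) → inj₂ i , p })
    (λ { (inj₁ i , p) → inj₁ (i , p) ; (inj₂ i , p) → inj₂ (i , p) })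
    (any? (P? ∘ inj₁) ⊎-dec any? (P? ∘ inj₂))

module CrownLowerBound
  {n k : ℕ} (c : Fin n ⊎ Fin n → Fin k) (σ : Fin n ⊎ Fin n → ℕ)
  (σ-injective : Injective _≡_ _≡_ σ) (cliques : CliqueClasses (CR n) c)
  (consecutive : Consecutive (CR n) σ c) (consistent : Consistent (CR n) σ c)
  where

  open ConsistentCliquePartition (CR n) CrownE-irrefl CrownE-triangle-free
    c σ σ-injective cliques consecutive consistent

  -- The edge u′v′ contains a neighbour or the twin of u, and
  -- neighbour-of-first-precedes rules out the neighbours.
  pairs-twin-order : ∀ {u v u′ v′} → c u ≡ c v → σ u < σ v → c u′ ≡ c v′ → σ u′ < σ v′ →
                     σ v < σ u′ → σ v < σ (twin u) × σ (twin u′) < σ v′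
  pairs-twin-order {u} {v} {u′} {v′} cu≡cv u<v cu′≡cv′ u′<v′ v<u′
    with edge-meets-neighbour-or-twin u u′ v′ (cliques u′ v′ cu′≡cv′ (σ<⇒≢ u′<v′))
  ... | inj₁ (inj₁ uu′) =
    ⊥-elim (<-asym (<-trans u<v v<u′) (neighbour-of-first-precedes cu≡cv u<v uu′ (σ<⇒≢ v<u′ ∘ sym)))
  ... | inj₁ (inj₂ refl) =
    v<u′ , subst (λ x → σ x < σ v′) (sym (twin-involutive u)) (<-trans (<-trans u<v v<u′) u′<v′)
  ... | inj₂ (inj₁ uv′) =
    ⊥-elim (<-asym (<-trans (<-trans u<v v<u′) u′<v′)
                   (neighbour-of-first-precedes cu≡cv u<v uv′ (σ<⇒≢ (<-trans v<u′ u′<v′) ∘ sym)))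
  ... | inj₂ (inj₂ refl) = <-trans v<u′ u′<v′ , twin-u′<twin-u
    where
    twin-u′<twin-u : σ (twin u′) < σ (twin u)
    twin-u′<twin-u with σ (twin u′) ≟ σ v
    ... | yes tu′≈v = subst (_< σ (twin u)) (sym tu′≈v) (<-trans v<u′ u′<v′)
    ... | no tu′≉v = <-trans
      (neighbour-of-first-precedes cu≡cv u<v
        (twin-adjacent-swap u u′ (σ<⇒≢ (<-trans u<v v<u′)) (cliques u′ (twin u) cu′≡cv′ (σ<⇒≢ u′<v′)))
        (tu′≉v ∘ cong σ))
      (<-trans (<-trans u<v v<u′) u′<v′)

  twin-bit : ∀ v → HasEarlierMate v → Bool
  twin-bit v (u , _) = does (σ v <? σ (twin u))

  twin-bit-injective : ∀ {v w} (v-second : HasEarlierMate v) (w-second : HasEarlierMate w) →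
                       c v ≢ c w → twin-bit v v-second ≢ twin-bit w w-second
  twin-bit-injective (u , cu≡cv , u<v) (u′ , cu′≡cw , u′<w) cv≢cw with <-cmp (σ u) (σ u′)
  ... | tri< u<u′ _ _ =
    let v<u′ = mate-precedes-other-class cu≡cv u<u′ (λ cv≡cu′ → cv≢cw (trans cv≡cu′ cu′≡cw))
        (v<tu , tu′<w) = pairs-twin-order cu≡cv u<v cu′≡cw u′<w v<u′
    in does-<?-≢ v<tu tu′<w
  ... | tri≈ _ u≈u′ _ = λ _ → cv≢cw (trans (sym cu≡cv) (trans (cong c (σ-injective u≈u′)) cu′≡cw))
  ... | tri> _ _ u′<u =
    let w<u = mate-precedes-other-class cu′≡cw u′<u (λ cw≡cu → cv≢cw (sym (trans cw≡cu cu≡cv)))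
        (w<tu′ , tu<v) = pairs-twin-order cu′≡cw u′<w cu≡cv u<v w<u
    in does-<?-≢ w<tu′ tu<v ∘ sym

  code : ∀ v → Dec (HasEarlierMate v) → Fin k ⊎ Bool
  code v (yes v-second) = inj₂ (twin-bit v v-second)
  code v (no _) = inj₁ (c v)

  code-injective : ∀ {v w} (dv : Dec (HasEarlierMate v)) (dw : Dec (HasEarlierMate w)) →
                   code v dv ≡ code w dw → v ≡ w
  code-injective (no v-first) (no w-first) eq = first-in-class-unique v-first w-first (inj₁-injective eq)
  code-injective {v} {w} (yes v-second) (yes w-second) eq with c v ≟ᶠ c w
  ... | yes cv≡cw = second-in-class-unique v-second w-second cv≡cw
  ... | no cv≢cw = ⊥-elim (twin-bit-injective v-second w-second cv≢cw (inj₂-injective eq))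

  has-earlier-mate? : ∀ v → Dec (HasEarlierMate v)
  has-earlier-mate? v = ∃-⊎? (λ u → (c u ≟ᶠ c v) ×-dec (σ u <? σ v))

  crown-size≤ : n + n ≤ k + 2
  crown-size≤ =
    injective⇒card≤ (↔-sym +↔⊎) (↔-trans (↔-refl ⊎-↔ ↔-sym 2↔Bool) (↔-sym +↔⊎))
      {f = λ v → code v (has-earlier-mate? v)}
      (code-injective (has-earlier-mate? _) (has-earlier-mate? _))

crown-lower-bound : ∀ n {k} → HasCmpPrecPartition (CR n) k → 2 * n ∸ 2 ≤ k
crown-lower-bound n {k} (c , σ , _ , σ-injective , cliques , consecutive , consistent) = begin
  2 * n ∸ 2 ≡⟨ cong (λ x → n + x ∸ 2) (+-identityʳ n) ⟩
  n + n ∸ 2 ≤⟨ ∸-monoˡ-≤ 2 (CrownLowerBound.crown-size≤ c σ σ-injective cliques consecutive consistent) ⟩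
  k + 2 ∸ 2 ≡⟨ m+n∸n≡m k 2 ⟩
  k         ∎
  where open ≤-Reasoning

rank : ℕ → Bool → ℕ
rank zero    false = 0
rank zero    true  = 1
rank (suc a) b     = suc (suc (rank a b))

rank-injective : ∀ {a a′ b b′} → rank a b ≡ rank a′ b′ → a ≡ a′ × b ≡ b′
rank-injective {zero}  {zero}   {false} {false} _  = refl , refl
rank-injective {zero}  {zero}   {true}  {true}  _  = refl , refl
rank-injective {suc a} {suc a′} eq with rank-injective {a} {a′} (suc-injective (suc-injective eq))
... | a≡a′ , b≡b′ = cong suc a≡a′ , b≡b′
rank-injective {zero}  {zero}   {false} {true}  ()
rank-injective {zero}  {zero}   {true}  {false} ()
rank-injective {zero}  {suc _}  {false} ()
rank-injective {zero}  {suc _}  {true}  ()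
rank-injective {suc _} {zero}   {_}     {false} ()
rank-injective {suc _} {zero}   {_}     {true}  ()

rank<⇒≤ : ∀ {a a′ b b′} → rank a b < rank a′ b′ → a ≤ a′
rank<⇒≤ {zero}                        _              = z≤n
rank<⇒≤ {suc _} {zero}  {_} {false}   ()
rank<⇒≤ {suc _} {zero}  {_} {true}    (s≤s ())
rank<⇒≤ {suc _} {suc _}               (s≤s (s≤s lt)) = s≤s (rank<⇒≤ lt)

rank-monoˡ-< : ∀ {a a′} b b′ → a < a′ → rank a b < rank a′ b′
rank-monoˡ-< {zero}  false _  (s≤s _)    = s≤s z≤n
rank-monoˡ-< {zero}  true  _  (s≤s _)    = s≤s (s≤s z≤n)
rank-monoˡ-< {suc _} b     b′ (s≤s a<a′) = s≤s (s≤s (rank-monoˡ-< b b′ a<a′))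

rank-false<true : ∀ a → rank a false < rank a true
rank-false<true zero    = s≤s z≤n
rank-false<true (suc a) = s≤s (s≤s (rank-false<true a))

rank-bit< : ∀ a {b b′} → rank a b < rank a b′ → b ≡ false × b′ ≡ true
rank-bit< a {false} {false} lt = ⊥-elim (<-irrefl refl lt)
rank-bit< a {false} {true}  _  = refl , refl
rank-bit< a {true}  {false} lt = ⊥-elim (<-asym lt (rank-false<true a))
rank-bit< a {true}  {true}  lt = ⊥-elim (<-irrefl refl lt)

-- The ordering is inj₂ 2, …, inj₂ (n-1), inj₁ 0, inj₂ 1, inj₁ 1, inj₂ 0,
-- inj₁ 2, …, inj₁ (n-1), and the only non-singleton classes are the two
-- consecutive pairs in the middle.  A slot is the class index split as in
-- Fin (m + (2 + (m + 0))), which is how Fin (2 * n ∸ 2) computes.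
module CrownPartition (m : ℕ) where

  private
    n : ℕ
    n = suc (suc m)

    Vertex : Set
    Vertex = Fin n ⊎ Fin n

  Slot : Set
  Slot = Fin m ⊎ Fin (2 + (m + 0))

  pad : Fin m → Fin (m + 0)
  pad = cast (sym (+-identityʳ m))

  unpad : Fin (m + 0) → Fin m
  unpad = cast (+-identityʳ m)

  unpad-pad : ∀ i → unpad (pad i) ≡ i
  unpad-pad = cast-involutive (+-identityʳ m) (sym (+-identityʳ m))

  pad-unpad : ∀ t → pad (unpad t) ≡ t
  pad-unpad = cast-involutive (sym (+-identityʳ m)) (+-identityʳ m)

  slot : Vertex → Slot
  slot (inj₂ (suc (suc i))) = inj₁ i
  slot (inj₁ zero)          = inj₂ zero
  slot (inj₂ (suc zero))    = inj₂ zero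
  slot (inj₁ (suc zero))    = inj₂ (suc zero)
  slot (inj₂ zero)          = inj₂ (suc zero)
  slot (inj₁ (suc (suc i))) = inj₂ (suc (suc (pad i)))

  bit : Vertex → Bool
  bit (inj₂ zero)       = true
  bit (inj₂ (suc zero)) = true
  bit _                 = false

  vertex : Slot → Bool → Vertex
  vertex (inj₁ i)             _     = inj₂ (suc (suc i))
  vertex (inj₂ zero)          false = inj₁ zero
  vertex (inj₂ zero)          true  = inj₂ (suc zero)
  vertex (inj₂ (suc zero))    false = inj₁ (suc zero)
  vertex (inj₂ (suc zero))    true  = inj₂ zero
  vertex (inj₂ (suc (suc t))) _     = inj₁ (suc (suc (unpad t)))

  vertex-slot : ∀ v → vertex (slot v) (bit v) ≡ v
  vertex-slot (inj₂ (suc (suc i))) = refl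
  vertex-slot (inj₁ zero)          = refl
  vertex-slot (inj₂ (suc zero))    = refl
  vertex-slot (inj₁ (suc zero))    = refl
  vertex-slot (inj₂ zero)          = refl
  vertex-slot (inj₁ (suc (suc i))) = cong (λ j → inj₁ (suc (suc j))) (unpad-pad i)

  slot-vertex : ∀ s → slot (vertex s false) ≡ s
  slot-vertex (inj₁ i)             = refl
  slot-vertex (inj₂ zero)          = refl
  slot-vertex (inj₂ (suc zero))    = refl
  slot-vertex (inj₂ (suc (suc t))) = cong (λ j → inj₂ (suc (suc j))) (pad-unpad t)

  data Pair : Vertex → Vertex → Set where
    pair₀ : Pair (inj₁ zero) (inj₂ (suc zero))
    pair₁ : Pair (inj₁ (suc zero)) (inj₂ zero)

  vertex-pair : ∀ s → vertex s false ≡ vertex s true ⊎ Pair (vertex s false) (vertex s true)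
  vertex-pair (inj₁ i)             = inj₁ refl
  vertex-pair (inj₂ zero)          = inj₂ pair₀
  vertex-pair (inj₂ (suc zero))    = inj₂ pair₁
  vertex-pair (inj₂ (suc (suc t))) = inj₁ refl

  pair-adjacent : ∀ {u v} → Pair u v → CrownE n u v
  pair-adjacent pair₀ ()
  pair-adjacent pair₁ ()

  class : Vertex → Fin (2 * n ∸ 2)
  class v = join m _ (slot v)

  σ : Vertex → ℕ
  σ v = rank (toℕ (class v)) (bit v)

  class≡⇒slot≡ : ∀ {u v} → class u ≡ class v → slot u ≡ slot v
  class≡⇒slot≡ {u} {v} cu≡cv = begin
    slot u                      ≡⟨ splitAt-join m _ (slot u) ⟨
    splitAt m (class u)         ≡⟨ cong (splitAt m) cu≡cv ⟩
    splitAt m (class v)         ≡⟨ splitAt-join m _ (slot v) ⟩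
    slot v                      ∎
    where open ≡-Reasoning

  class-bit-injective : ∀ {u v} → class u ≡ class v → bit u ≡ bit v → u ≡ v
  class-bit-injective {u} {v} cu≡cv bu≡bv = begin
    u                           ≡⟨ vertex-slot u ⟨
    vertex (slot u) (bit u)     ≡⟨ cong₂ vertex (class≡⇒slot≡ cu≡cv) bu≡bv ⟩
    vertex (slot v) (bit v)     ≡⟨ vertex-slot v ⟩
    v                           ∎
    where open ≡-Reasoning

  same-class-ordered : ∀ {u v} → class u ≡ class v → σ u < σ v → Pair u v
  same-class-ordered {u} {v} cu≡cv u<v
    with rank-bit< (toℕ (class v)) (subst (λ j → rank (toℕ j) (bit u) < σ v) cu≡cv u<v)
  ... | bu≡false , bv≡true =
    [ (λ same → ⊥-elim (<-irrefl (cong σ (trans (sym u≡) (trans same v≡))) u<v))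
    , subst₂ Pair u≡ v≡
    ]′ (vertex-pair (slot u))
    where
    u≡ : vertex (slot u) false ≡ u
    u≡ = subst (λ b → vertex (slot u) b ≡ u) bu≡false (vertex-slot u)
    v≡ : vertex (slot u) true ≡ v
    v≡ = subst₂ (λ s b → vertex s b ≡ v) (sym (class≡⇒slot≡ cu≡cv)) bv≡true (vertex-slot v)

  surjective : Surjective _≡_ _≡_ class
  surjective j = vertex (splitAt m j) false , λ { refl →
    trans (cong (join m _) (slot-vertex (splitAt m j))) (join-splitAt m _ j) }

  σ-injective : Injective _≡_ _≡_ σ
  σ-injective σu≡σv with rank-injective σu≡σv
  ... | cu≡cv , bu≡bv = class-bit-injective (toℕ-injective cu≡cv) bu≡bv

  cliques : CliqueClasses (CR n) class
  cliques u v cu≡cv u≢v with <-cmp (σ u) (σ v)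
  ... | tri< u<v _ _ = pair-adjacent (same-class-ordered cu≡cv u<v)
  ... | tri≈ _ u≈v _ = ⊥-elim (u≢v (σ-injective u≈v))
  ... | tri> _ _ v<u = CrownE-sym v u (pair-adjacent (same-class-ordered (sym cu≡cv) v<u))

  singleton<pair : ∀ (i : Fin m) (t : Fin (2 + (m + 0))) →
                   toℕ (class (inj₂ (suc (suc i)))) < toℕ (m ↑ʳ t)
  singleton<pair i t rewrite toℕ-↑ˡ i (2 + (m + 0)) | toℕ-↑ʳ m t =
    ≤-trans (toℕ<n i) (m≤m+n m (toℕ t))

  ↑ʳ-mono-< : ∀ {s t : Fin (2 + (m + 0))} → toℕ s < toℕ t → toℕ (m ↑ʳ s) < toℕ (m ↑ʳ t)
  ↑ʳ-mono-< {s} {t} s<t rewrite toℕ-↑ʳ m s | toℕ-↑ʳ m t = +-monoʳ-< m s<t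

  first-neighbours-precede : ∀ {p q} → Pair p q → ∀ r → CrownE n p r → σ r ≤ σ q
  first-neighbours-precede pair₀ (inj₂ zero)          p≁r = ⊥-elim (p≁r refl)
  first-neighbours-precede pair₀ (inj₂ (suc zero))    _   = ≤-refl
  first-neighbours-precede pair₀ (inj₂ (suc (suc i))) _   =
    <⇒≤ (rank-monoˡ-< false true (singleton<pair i zero))
  first-neighbours-precede pair₁ (inj₂ zero)          _   = ≤-refl
  first-neighbours-precede pair₁ (inj₂ (suc zero))    p≁r = ⊥-elim (p≁r refl)
  first-neighbours-precede pair₁ (inj₂ (suc (suc i))) _   =
    <⇒≤ (rank-monoˡ-< false true (singleton<pair i (suc zero)))

  second-neighbours-follow : ∀ {p q} → Pair p q → ∀ r → CrownE n q r → σ p ≤ σ r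
  second-neighbours-follow pair₀ (inj₁ zero)          _   = ≤-refl
  second-neighbours-follow pair₀ (inj₁ (suc zero))    q≁r = ⊥-elim (q≁r refl)
  second-neighbours-follow pair₀ (inj₁ (suc (suc i))) _   =
    <⇒≤ (rank-monoˡ-< false false (↑ʳ-mono-< {zero} {suc (suc (pad i))} (s≤s z≤n)))
  second-neighbours-follow pair₁ (inj₁ zero)          q≁r = ⊥-elim (q≁r refl)
  second-neighbours-follow pair₁ (inj₁ (suc zero))    _   = ≤-refl
  second-neighbours-follow pair₁ (inj₁ (suc (suc i))) _   =
    <⇒≤ (rank-monoˡ-< false false (↑ʳ-mono-< {suc zero} {suc (suc (pad i))} (s≤s (s≤s z≤n))))

  partition : HasCmpPrecProperPartition (CR n) (2 * n ∸ 2)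
  partition = class , σ , surjective , σ-injective , cliques ,
    monotone⇒consecutive (CR n) class σ rank<⇒≤ ,
    neighbours-precede⇒consistent (CR n) class σ
      (λ p q r p<q cp≡cq → first-neighbours-precede (same-class-ordered cp≡cq p<q) r) ,
    neighbours-follow⇒reverseConsistent (CR n) class σ
      (λ p q r p<q cp≡cq → second-neighbours-follow (same-class-ordered cp≡cq p<q) r)

crown₁-partition : HasCmpPrecProperPartition (CR 1) 2
crown₁-partition = side , toℕ ∘ side , surjective , side-injective ∘ toℕ-injective , cliques ,
  monotone⇒consecutive (CR 1) side (toℕ ∘ side) <⇒≤ ,
  neighbours-precede⇒consistent (CR 1) side (toℕ ∘ side) (λ _ _ _ p<q cp≡cq → ⊥-elim (singletons p<q cp≡cq)) ,
  neighbours-follow⇒reverseConsistent (CR 1) side (toℕ ∘ side) (λ _ _ _ p<q cp≡cq → ⊥-elim (singletons p<q cp≡cq))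
  where
  side : Fin 1 ⊎ Fin 1 → Fin 2
  side (inj₁ _) = zero
  side (inj₂ _) = suc zero

  side-injective : Injective _≡_ _≡_ side
  side-injective {inj₁ zero} {inj₁ zero} _ = refl
  side-injective {inj₂ zero} {inj₂ zero} _ = refl

  surjective : Surjective _≡_ _≡_ side
  surjective zero       = inj₁ zero , λ { refl → refl }
  surjective (suc zero) = inj₂ zero , λ { refl → refl }

  cliques : CliqueClasses (CR 1) side
  cliques u v su≡sv u≢v = ⊥-elim (u≢v (side-injective su≡sv))

  singletons : ∀ {p q} → toℕ (side p) < toℕ (side q) → side p ≢ side q
  singletons p<q sp≡sq = <-irrefl (cong toℕ sp≡sq) p<q

crown₁-lower-bound : ∀ {k} → HasCmpPrecPartition (CR 1) k → 2 ≤ k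
crown₁-lower-bound {zero} (c , _) = ⊥-elim (¬Fin0 (c (inj₁ zero)))
crown₁-lower-bound {suc zero} (c , _ , _ , _ , cliques , _) =
  ⊥-elim (cliques (inj₁ zero) (inj₂ zero) (Fin1-unique _ _) (λ ()) refl)
  where
  Fin1-unique : (i j : Fin 1) → i ≡ j
  Fin1-unique zero zero = refl
crown₁-lower-bound {suc (suc k)} _ = s≤s (s≤s z≤n)

theorem22 :
    ((n : ℕ) → 2 ≤ n → ThinCmpPrec≡ (CR n) (2 * n ∸ 2)) ×
    ThinCmpPrec≡ (CR 1) 2 ×
    ((n : ℕ) → 2 ≤ n → PThinCmpPrec≡ (CR n) (2 * n ∸ 2)) ×
    PThinCmpPrec≡ (CR 1) 2
theorem22 =
  thin ,
  (proper⇒partition (CR 1) crown₁-partition , λ _ → crown₁-lower-bound) ,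
  pthin ,
  (crown₁-partition , λ _ → crown₁-lower-bound ∘ proper⇒partition (CR 1))
  where
  thin : (n : ℕ) → 2 ≤ n → ThinCmpPrec≡ (CR n) (2 * n ∸ 2)
  thin (suc zero) (s≤s ())
  thin (suc (suc m)) _ =
    proper⇒partition (CR _) (CrownPartition.partition m) , λ _ → crown-lower-bound _
  pthin : (n : ℕ) → 2 ≤ n → PThinCmpPrec≡ (CR n) (2 * n ∸ 2)
  pthin (suc zero) (s≤s ())
  pthin (suc (suc m)) _ =
    CrownPartition.partition m , λ _ → crown-lower-bound _ ∘ proper⇒partition (CR _)
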